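{- For all integers $r\ge 1$ and $s,t\ge 2$, $$R^{\mathrm{KG}}_r(s,t)\ge R(s,t)+2r-2.$$
   Context: $R(s,t)$ is the classical Ramsey number: the least $n$ such that every red/blue edge-coloring of $K_n$ contains a red $K_s$ or a blue $K_t$. The Kneser graph $\mathrm{KG}(n,r)$ has vertex set the $r$-element subsets of $[n]=\{1,\dots,n\}$, with two sets adjacent iff they are disjoint. The $r$-Kneser Ramsey number $R^{\mathrm{KG}}_r(s,t)$ is the minimum integer $n$ such that every red/blue edge-coloring of $\mathrm{KG}(n,r)$ contains a red $K_s$ (a set of $s$ pairwise adjacent vertices with all connecting edges red) or a blue $K_t$. -}

module Defs where

open import Data.Nat using (ℕ)
open import Data.Bool using (Bool; true; false)
open import Data.Fin using (Fin)
open import Data.Fin.Subset using (Subset; ∣_∣; _∩_; ⊥; _∈_)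
open import Data.Product using (Σ; _×_; _,_; proj₁)
open import Data.Sum using (_⊎_)
open import Data.Nat using (_≤_)
open import Relation.Binary.PropositionalEquality using (_≡_; _≢_)
open import Relation.Nullary using (¬_)

-- A red/blue edge colouring of a graph on vertex type V is a symmetric
-- function V → V → Bool (true = red, false = blue); only its values on
-- edges matter.
Symmetric : ∀ {V : Set} → (V → V → Bool) → Set
Symmetric {V} c = ∀ (x y : V) → c x y ≡ c y x

MonoClique : ∀ {V : Set} → (V → V → Set) → (V → V → Bool) → Bool → ℕ → Set
MonoClique {V} adj c b k =
  Σ (Fin k → V) λ f →
    ∀ (i j : Fin k) → i ≢ j → (f i ≢ f j) × adj (f i) (f j) × (c (f i) (f j) ≡ b)

Arrows : ∀ {V : Set} → (V → V → Set) → ℕ → ℕ → Set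
Arrows {V} adj s t =
  ∀ (c : V → V → Bool) → Symmetric c → MonoClique adj c true s ⊎ MonoClique adj c false t

CompleteAdj : (n : ℕ) → Fin n → Fin n → Set
CompleteAdj n x y = x ≢ y

KVertex : ℕ → ℕ → Set
KVertex n r = Σ (Subset n) λ A → ∣ A ∣ ≡ r

KneserAdj : (n r : ℕ) → KVertex n r → KVertex n r → Set
KneserAdj n r (A , _) (B , _) = A ∩ B ≡ ⊥

RamseyProperty : ℕ → ℕ → ℕ → Set
RamseyProperty s t n = Arrows (CompleteAdj n) s t

KneserRamseyProperty : ℕ → ℕ → ℕ → ℕ → Set
KneserRamseyProperty r s t n = Arrows (KneserAdj n r) s t

IsLeast : (ℕ → Set) → ℕ → Set
IsLeast P n = P n × (∀ m → P m → n ≤ m)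

IsRamseyNumber : ℕ → ℕ → ℕ → Set
IsRamseyNumber s t N = IsLeast (RamseyProperty s t) N

IsKneserRamseyNumber : ℕ → ℕ → ℕ → ℕ → Set
IsKneserRamseyNumber r s t M = IsLeast (KneserRamseyProperty r s t) M

-- Sending an r-set to its least element, with all least elements ≥ k lumped
-- together, is a homomorphism KG(k + 2r - 1, r) → K_(k+1): disjoint sets have
-- distinct least elements, and two disjoint r-sets cannot both fit into the
-- last 2r - 1 points. Pulling colourings of K_(k+1) back along it, every
-- colouring of K_(M - 2r + 2) has a red K_s or a blue K_t whenever this holds
-- for KG(M, r), so R(s,t) ≤ M - 2r + 2.
module Submission where

open import Defs
open import Data.Nat using (ℕ; zero; suc; _+_; _*_; _∸_; _≤_; _<_; z≤n; s≤s)
open import Data.Nat.Properties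
  using (module ≤-Reasoning; suc-injective; +-suc; +-identityʳ; m≤n⇒m≤1+n; <-irrefl;
         ≤-trans; ≤-reflexive; +-monoˡ-≤; +-monoʳ-≤; n≤1+n; ∸-monoˡ-≤; m≤n⇒∃[o]m+o≡n)
open import Data.Nat.Tactic.RingSolver using (solve-∀)
open import Data.Bool using (Bool; true; false)
open import Data.Vec using ([]; _∷_; tail)
open import Data.Fin using (Fin)
import Data.Fin as Fin
import Data.Fin.Properties as Fin
open import Data.Fin.Subset using (Subset; ∣_∣; _∩_)
import Data.Fin.Subset as Subset
open import Data.Product using (∃₂; _×_; _,_)
open import Data.Sum using (_⊎_; inj₁; inj₂; map)
open import Relation.Binary.PropositionalEquality
  using (_≡_; _≢_; refl; sym; cong; subst; subst₂)

record IsHomomorphism {V W : Set} (adjV : V → V → Set) (adjW : W → W → Set) (φ : V → W)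
                      : Set where
  field
    separates : ∀ {x y} → adjV x y → φ x ≢ φ y
    preserves : ∀ {x y} → adjV x y → adjW (φ x) (φ y)

pullback : ∀ {V W : Set} → (V → W) → (W → W → Bool) → V → V → Bool
pullback φ c x y = c (φ x) (φ y)

MonoClique-map : ∀ {V W : Set} {adjV : V → V → Set} {adjW : W → W → Set} {φ : V → W} →
  IsHomomorphism adjV adjW φ → ∀ c b k → MonoClique adjV (pullback φ c) b k → MonoClique adjW c b k
MonoClique-map {φ = φ} hom c b k (f , clique) = (λ i → φ (f i)) , λ i j i≢j →
  let (_ , adj , colour) = clique i j i≢j
  in separates adj , preserves adj , colour
  where open IsHomomorphism hom

Arrows-map : ∀ {V W : Set} {adjV : V → V → Set} {adjW : W → W → Set} {φ : V → W} →
  IsHomomorphism adjV adjW φ → ∀ s t → Arrows adjV s t → Arrows adjW s t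
Arrows-map {φ = φ} hom s t arrows c c-sym with arrows (pullback φ c) (λ x y → c-sym (φ x) (φ y))
... | inj₁ red  = inj₁ (MonoClique-map hom c true s red)
... | inj₂ blue = inj₂ (MonoClique-map hom c false t blue)

MonoClique⇒edge : ∀ {V : Set} {adj : V → V → Set} {c b k} →
  2 ≤ k → MonoClique adj c b k → ∃₂ adj
MonoClique⇒edge {k = suc zero} (s≤s ()) _
MonoClique⇒edge {k = suc (suc k)} _ (f , clique) =
  let (_ , adj , _) = clique Fin.zero (Fin.suc Fin.zero) (λ ()) in _ , _ , adj

Arrows⇒edge : ∀ {V : Set} {adj : V → V → Set} {s t} → 2 ≤ s → 2 ≤ t → Arrows adj s t → ∃₂ adj
Arrows⇒edge 2≤s 2≤t arrows with arrows (λ _ _ → true) (λ _ _ → refl)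
... | inj₁ red  = MonoClique⇒edge 2≤s red
... | inj₂ blue = MonoClique⇒edge 2≤t blue

-- The empty subset of Fin n gets the value n.
firstElem : ∀ {n} → Subset n → ℕ
firstElem []          = 0
firstElem (true ∷ p)  = 0
firstElem (false ∷ p) = suc (firstElem p)

disjoint⇒firstElem≢ : ∀ {n} (p q : Subset n) → p ∩ q ≡ Subset.⊥ → 1 ≤ ∣ p ∣ →
  firstElem p ≢ firstElem q
disjoint⇒firstElem≢ (true ∷ p)  (true ∷ q)  ()
disjoint⇒firstElem≢ (true ∷ p)  (false ∷ q) _    _ ()
disjoint⇒firstElem≢ (false ∷ p) (true ∷ q)  _    _ ()
disjoint⇒firstElem≢ (false ∷ p) (false ∷ q) p∩q 1≤∣p∣ eq =
  disjoint⇒firstElem≢ p q (cong tail p∩q) 1≤∣p∣ (suc-injective eq)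

disjoint⇒∣p∣+∣q∣≤n : ∀ {n} (p q : Subset n) → p ∩ q ≡ Subset.⊥ → ∣ p ∣ + ∣ q ∣ ≤ n
disjoint⇒∣p∣+∣q∣≤n []          []          _    = z≤n
disjoint⇒∣p∣+∣q∣≤n (true ∷ p)  (true ∷ q)  ()
disjoint⇒∣p∣+∣q∣≤n (true ∷ p)  (false ∷ q) p∩q =
  s≤s (disjoint⇒∣p∣+∣q∣≤n p q (cong tail p∩q))
disjoint⇒∣p∣+∣q∣≤n (false ∷ p) (true ∷ q)  p∩q =
  ≤-trans (≤-reflexive (+-suc ∣ p ∣ ∣ q ∣)) (s≤s (disjoint⇒∣p∣+∣q∣≤n p q (cong tail p∩q)))
disjoint⇒∣p∣+∣q∣≤n (false ∷ p) (false ∷ q) p∩q =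
  m≤n⇒m≤1+n (disjoint⇒∣p∣+∣q∣≤n p q (cong tail p∩q))

disjoint-above⇒∣p∣+∣q∣+k≤n : ∀ {n} k (p q : Subset n) → p ∩ q ≡ Subset.⊥ →
  k ≤ firstElem p → k ≤ firstElem q → ∣ p ∣ + ∣ q ∣ + k ≤ n
disjoint-above⇒∣p∣+∣q∣+k≤n zero p q p∩q _ _ =
  ≤-trans (≤-reflexive (+-identityʳ _)) (disjoint⇒∣p∣+∣q∣≤n p q p∩q)
disjoint-above⇒∣p∣+∣q∣+k≤n (suc k) (false ∷ p) (false ∷ q) p∩q (s≤s k≤p) (s≤s k≤q) =
  ≤-trans (≤-reflexive (+-suc (∣ p ∣ + ∣ q ∣) k))
    (s≤s (disjoint-above⇒∣p∣+∣q∣+k≤n k p q (cong tail p∩q) k≤p k≤q))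

KneserAdj⇒2r≤n : ∀ {n r} (A B : KVertex n r) → KneserAdj n r A B → r + r ≤ n
KneserAdj⇒2r≤n (p , ∣p∣≡r) (q , ∣q∣≡r) p∩q =
  subst₂ (λ a b → a + b ≤ _) ∣p∣≡r ∣q∣≡r (disjoint⇒∣p∣+∣q∣≤n p q p∩q)

clamp : ∀ k → ℕ → Fin (suc k)
clamp zero    _       = Fin.zero
clamp (suc k) zero    = Fin.zero
clamp (suc k) (suc m) = Fin.suc (clamp k m)

clamp-injective-below : ∀ k {m m′} → clamp k m ≡ clamp k m′ → m ≡ m′ ⊎ (k ≤ m × k ≤ m′)
clamp-injective-below zero    _  = inj₂ (z≤n , z≤n)
clamp-injective-below (suc k) {zero}  {zero}   _  = inj₁ refl
clamp-injective-below (suc k) {suc m} {suc m′} eq =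
  map (cong suc) (λ (k≤m , k≤m′) → s≤s k≤m , s≤s k≤m′)
      (clamp-injective-below k (Fin.suc-injective eq))

leastClamped : ∀ {n r} k → KVertex n r → Fin (suc k)
leastClamped k (p , _) = clamp k (firstElem p)

leastClamped-isHomomorphism : ∀ {n r} k → 1 ≤ r → n < r + r + k →
  IsHomomorphism (KneserAdj n r) (CompleteAdj (suc k)) (leastClamped k)
leastClamped-isHomomorphism {n} {r} k 1≤r n<2r+k = record
  { separates = λ {A} {B} → distinct A B ; preserves = λ {A} {B} → distinct A B }
  where
  distinct : ∀ A B → KneserAdj n r A B → leastClamped k A ≢ leastClamped k B
  distinct (p , ∣p∣≡r) (q , ∣q∣≡r) p∩q eq with clamp-injective-below k eq
  ... | inj₁ same = disjoint⇒firstElem≢ p q p∩q (subst (1 ≤_) (sym ∣p∣≡r) 1≤r) same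
  ... | inj₂ (k≤p , k≤q) = <-irrefl refl (≤-trans n<2r+k
          (subst₂ (λ a b → a + b + k ≤ n) ∣p∣≡r ∣q∣≡r
            (disjoint-above⇒∣p∣+∣q∣+k≤n k p q p∩q k≤p k≤q)))

KneserRamsey⇒Ramsey : ∀ {s t} r′ k →
  KneserRamseyProperty (suc r′) s t (suc r′ + r′ + k) → RamseyProperty s t (suc k)
KneserRamsey⇒Ramsey r′ k =
  Arrows-map (leastClamped-isHomomorphism k (s≤s z≤n) (≤-reflexive (2r+k≡1+[2r-1+k] r′ k))) _ _
  where
  2r+k≡1+[2r-1+k] : ∀ r′ k → suc (suc r′ + r′ + k) ≡ suc r′ + suc r′ + k
  2r+k≡1+[2r-1+k] = solve-∀

KneserRamsey⇒2r≤n : ∀ {r s t n} → 2 ≤ s → 2 ≤ t → KneserRamseyProperty r s t n → r + r ≤ n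
KneserRamsey⇒2r≤n {r} {n = n} 2≤s 2≤t arrows =
  let (A , B , A~B) = Arrows⇒edge {adj = KneserAdj n r} 2≤s 2≤t arrows in KneserAdj⇒2r≤n A B A~B

1+k+2r∸2≡2r-1+k : ∀ r′ k → suc k + 2 * suc r′ ∸ 2 ≡ suc r′ + r′ + k
1+k+2r∸2≡2r-1+k r′ k = cong (_∸ 2) (lemma r′ k)
  where
  lemma : ∀ r′ k → suc k + 2 * suc r′ ≡ 2 + (suc r′ + r′ + k)
  lemma = solve-∀

proposition1p10 : ∀ (r s t : ℕ) → 1 ≤ r → 2 ≤ s → 2 ≤ t →
    ∀ (N M : ℕ) → IsRamseyNumber s t N → IsKneserRamseyNumber r s t M →
    N + 2 * r ∸ 2 ≤ M
proposition1p10 r@(suc r′) s t _ 2≤s 2≤t N M (_ , leastN) (arrowsM , _)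
  with m≤n⇒∃[o]m+o≡n (≤-trans (+-monoʳ-≤ r (n≤1+n r′)) (KneserRamsey⇒2r≤n 2≤s 2≤t arrowsM))
... | k , refl = begin
  N + 2 * r ∸ 2      ≤⟨ ∸-monoˡ-≤ 2 (+-monoˡ-≤ (2 * r) N≤1+k) ⟩
  suc k + 2 * r ∸ 2  ≡⟨ 1+k+2r∸2≡2r-1+k r′ k ⟩
  r + r′ + k         ∎
  where
  open ≤-Reasoning
  N≤1+k : N ≤ suc k
  N≤1+k = leastN (suc k) (KneserRamsey⇒Ramsey r′ k arrowsM)
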